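{- Let $n,k$ be positive integers with $\gcd(3k,n)=1$ and let $\phi_k:\mathbb{F}_{2^n}^2\to\mathbb{F}_{2^n}^2$ be $\phi_k(x,y)=(x^{2^k}+y,\;y^{2^k}+x+y)$. Then $\phi_k$ is a bijection. -}

module Defs where

open import Level using (Level; _⊔_)
open import Data.Nat using (ℕ; _^_)
open import Data.Fin using (Fin)
open import Data.Product using (_×_; _,_; ∃)
open import Relation.Nullary using (¬_)
open import Relation.Binary.PropositionalEquality as ≡ using (_≡_)
open import Algebra.Bundles using (CommutativeRing)
import Algebra.Bundles
import Algebra.Definitions.RawSemiring as RS
open import Function.Bundles using (Bijection)
open import Function.Definitions using (Bijective)

record IsField𝔽2^ {c ℓ : Level} (n : ℕ) (R : CommutativeRing c ℓ) : Set (c ⊔ ℓ) where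
  open CommutativeRing R
  field
    nontrivial : ¬ (1# ≈ 0#)
    inverse    : ∀ x → ¬ (x ≈ 0#) → ∃ λ y → x * y ≈ 1#
    char2      : 1# + 1# ≈ 0#
    card       : Bijection setoid (≡.setoid (Fin (2 ^ n)))

module _ {c ℓ : Level} (R : CommutativeRing c ℓ) where
  open CommutativeRing R
  open RS (Algebra.Bundles.Semiring.rawSemiring semiring) using () renaming (_^_ to _^ᴿ_)

  _≈²_ : Carrier × Carrier → Carrier × Carrier → Set ℓ
  (a , b) ≈² (c' , d) = (a ≈ c') × (b ≈ d)

  φ : ℕ → Carrier × Carrier → Carrier × Carrier
  φ k (x , y) = (x ^ᴿ (2 ^ k) + y , y ^ᴿ (2 ^ k) + x + y)

  φ-Bijective : ℕ → Set (c ⊔ ℓ)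
  φ-Bijective k = Bijective _≈²_ _≈²_ (φ k)

{-# OPTIONS --safe #-}

-- In characteristic 2 the map σ x = x^(2^k) is additive, hence so is φ_k, and it suffices
-- to show that φ_k has trivial kernel.  If φ_k (a , b) = 0 then b = σ a and
-- σ² a + a + σ a = 0; applying σ and comparing gives σ³ a = a.  Every element is also
-- fixed by x ↦ x^(2^n), so by Bézout it is fixed by x ↦ x^(2^gcd(3k,n)) = x², whence
-- σ a = a and 0 = 3a = a.  An injective self-map of the finite set F² is surjective.

module Submission where

open import Defs
open import Level using (Level)
open import Data.Nat as ℕ using (ℕ; zero; suc; _≤_)
open import Data.Nat.Properties using (1+n≰n; ^-distribˡ-+-*) renaming (+-identityʳ to +-identityʳ-ℕ)
open import Data.Nat.GCD using (gcd; GCD; gcd-GCD; module Bézout)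
open import Data.Fin as Fin using (Fin; punchIn)
open import Data.Fin.Properties using (punchInᵢ≢i; *↔×; any?; injective⇒≤; punchOut-injective)
open import Data.Fin.Permutation using (Permutation; permutation; _⟨$⟩ʳ_)
open import Data.Product using (_×_; _,_; ∃; proj₁; proj₂)
open import Data.Product.Relation.Binary.Pointwise.NonDependent using (_×ₛ_; Pointwise-≡↔≡)
open import Data.Product.Function.NonDependent.Setoid using (_×-bijection_)
open import Data.Vec.Functional using (replicate)
open import Function.Base using (_∘_)
open import Function.Bundles using (Bijection)
open import Function.Definitions using (Congruent; Injective; Surjective)
import Function.Properties.Bijection as Bij
open import Function.Properties.Inverse using (Inverse⇒Bijection; ↔⇒⤖; ↔-sym)
open import Relation.Binary.Bundles using (Setoid)
open import Relation.Binary.Definitions using (Decidable)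
open import Relation.Binary.PropositionalEquality as ≡ using (_≡_; _≢_)
open import Relation.Nullary using (¬_; yes; no)
open import Relation.Nullary.Decidable using (map′)
open import Relation.Nullary.Negation using (contradiction)
open import Algebra.Bundles using (CommutativeRing; CommutativeMonoid; Semiring)
import Algebra.Definitions.RawSemiring as RawSemiring
import Algebra.Properties.CommutativeMonoid.Sum as Sum

Fin-injective⇒surjective : ∀ {m} {f : Fin m → Fin m} → Injective _≡_ _≡_ f → ∀ j → ∃ λ i → f i ≡ j
Fin-injective⇒surjective {zero} _ ()
Fin-injective⇒surjective {suc m} {f} f-inj j with any? (λ i → f i Fin.≟ j)
... | yes hit = hit
... | no miss = contradiction (injective⇒≤ g-inj) 1+n≰n
  where
  j≢f : ∀ i → j ≢ f i
  j≢f i j≡fi = miss (i , ≡.sym j≡fi)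

  g : Fin (suc m) → Fin m
  g i = Fin.punchOut (j≢f i)

  g-inj : Injective _≡_ _≡_ g
  g-inj = f-inj ∘ punchOut-injective (j≢f _) (j≢f _)

×-finite : ∀ {a b ℓ₁ ℓ₂} {S : Setoid a ℓ₁} {T : Setoid b ℓ₂} {m n} →
           Bijection S (≡.setoid (Fin m)) → Bijection T (≡.setoid (Fin n)) →
           Bijection (S ×ₛ T) (≡.setoid (Fin (m ℕ.* n)))
×-finite cardS cardT = Bij.trans (cardS ×-bijection cardT)
  (Bij.trans (Inverse⇒Bijection Pointwise-≡↔≡) (↔⇒⤖ (↔-sym *↔×)))

module FiniteSetoid {c ℓ} (S : Setoid c ℓ) {N : ℕ} (card : Bijection S (≡.setoid (Fin N))) where
  open Setoid S
  open Bijection card using (to; to⁻; injective; strictlySurjective) renaming (cong to to-cong)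

  to∘to⁻ : ∀ i → to (to⁻ i) ≡ i
  to∘to⁻ i = proj₂ (strictlySurjective i)

  to⁻∘to : ∀ x → to⁻ (to x) ≈ x
  to⁻∘to x = injective (to∘to⁻ (to x))

  to⁻-injective : ∀ {i j} → to⁻ i ≈ to⁻ j → i ≡ j
  to⁻-injective {i} {j} e = ≡.trans (≡.sym (to∘to⁻ i)) (≡.trans (to-cong e) (to∘to⁻ j))

  _≟_ : Decidable _≈_
  x ≟ y = map′ injective to-cong (to x Fin.≟ to y)

  onIndices : (Carrier → Carrier) → Fin N → Fin N
  onIndices f i = to (f (to⁻ i))

  onIndices-inverse : ∀ {f g} → Congruent _≈_ _≈_ f → (∀ x → f (g x) ≈ x) →
                      ∀ i → onIndices f (onIndices g i) ≡ i
  onIndices-inverse f-cong f∘g≈id i = ≡.trans (to-cong (trans (f-cong (to⁻∘to _)) (f∘g≈id _))) (to∘to⁻ i)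

  toPermutation : ∀ {f g} → Congruent _≈_ _≈_ f → Congruent _≈_ _≈_ g →
                  (∀ x → f (g x) ≈ x) → (∀ x → g (f x) ≈ x) → Permutation N N
  toPermutation {f} {g} f-cong g-cong f∘g≈id g∘f≈id = permutation (onIndices f) (onIndices g)
    (onIndices-inverse f-cong f∘g≈id) (onIndices-inverse g-cong g∘f≈id)

  injective⇒surjective : ∀ {f} → Congruent _≈_ _≈_ f → Injective _≈_ _≈_ f → Surjective _≈_ _≈_ f
  injective⇒surjective {f} f-cong f-inj y
    with i , hit ← Fin-injective⇒surjective {f = onIndices f} (to⁻-injective ∘ f-inj ∘ injective) (to y)
    = to⁻ i , λ z≈x → trans (f-cong z≈x) (injective hit)

sum-concentrated : ∀ {a ℓ} (M : CommutativeMonoid a ℓ) → let open CommutativeMonoid M; open Sum M in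
                   ∀ {m} (f : Fin m → Carrier) (j : Fin m) → (∀ i → i ≢ j → f i ≈ ε) → sum f ≈ f j
sum-concentrated M {suc m} f j off-j≈ε = begin
  sum f                       ≈⟨ sum-remove f ⟩
  f j ∙ sum (f ∘ punchIn j)   ≈⟨ ∙-congˡ (sum-cong-≋ (λ i → off-j≈ε (punchIn j i) (punchInᵢ≢i j i))) ⟩
  f j ∙ sum (replicate m ε)   ≈⟨ ∙-congˡ (sum-replicate-zero m) ⟩
  f j ∙ ε                     ≈⟨ identityʳ (f j) ⟩
  f j                         ∎
  where
  open CommutativeMonoid M
  open Sum M
  open import Relation.Binary.Reasoning.Setoid setoid

module Field {c ℓ} (F : CommutativeRing c ℓ) where
  open CommutativeRing F
  open RawSemiring (Semiring.rawSemiring semiring) using () renaming (_^_ to _^ᴿ_)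
  open Sum *-commutativeMonoid using (sum-cong-≋; sum-replicate; sum-permute; ∑-distrib-+) renaming (sum to ∏)
  open import Algebra.Properties.Semiring.Exp semiring using (^-congˡ)
  open import Relation.Binary.Reasoning.Setoid setoid

  0#^nonempty : ∀ {m} → Fin m → 0# ^ᴿ m ≈ 0#
  0#^nonempty {suc m} _ = zeroˡ (0# ^ᴿ m)

  module Finite (1≉0 : ¬ 1# ≈ 0#) (inverse : ∀ x → ¬ x ≈ 0# → ∃ λ y → x * y ≈ 1#)
                {N : ℕ} (card : Bijection setoid (≡.setoid (Fin N))) where
    open FiniteSetoid setoid card using (_≟_; to⁻∘to; to⁻-injective; toPermutation)
    open Bijection card using (to; to⁻)

    inverse-cancelˡ : ∀ {x y} → x * y ≈ 1# → ∀ z → x * (y * z) ≈ z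
    inverse-cancelˡ {x} {y} xy≈1 z = begin
      x * (y * z)  ≈⟨ *-assoc x y z ⟨
      (x * y) * z  ≈⟨ *-congʳ xy≈1 ⟩
      1# * z       ≈⟨ *-identityˡ z ⟩
      z            ∎

    left-inverse : ∀ x → ¬ x ≈ 0# → ∃ λ x⁻¹ → x⁻¹ * x ≈ 1#
    left-inverse x x≉0 with x⁻¹ , xx⁻¹≈1 ← inverse x x≉0 = x⁻¹ , trans (*-comm x⁻¹ x) xx⁻¹≈1

    *-nonzero : ∀ {x y} → ¬ x ≈ 0# → ¬ y ≈ 0# → ¬ x * y ≈ 0#
    *-nonzero {x} {y} x≉0 y≉0 xy≈0 with x⁻¹ , x⁻¹x≈1 ← left-inverse x x≉0 = y≉0 (begin
      y              ≈⟨ inverse-cancelˡ x⁻¹x≈1 y ⟨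
      x⁻¹ * (x * y)  ≈⟨ *-congˡ xy≈0 ⟩
      x⁻¹ * 0#       ≈⟨ zeroʳ x⁻¹ ⟩
      0#             ∎)

    x*x≈0⇒x≈0 : ∀ {x} → x * x ≈ 0# → x ≈ 0#
    x*x≈0⇒x≈0 {x} xx≈0 with x ≟ 0#
    ... | yes x≈0 = x≈0
    ... | no  x≉0 = contradiction xx≈0 (*-nonzero x≉0 x≉0)

    *-cancelˡ-nonzero : ∀ {x y z} → ¬ x ≈ 0# → x * y ≈ x * z → y ≈ z
    *-cancelˡ-nonzero {x} {y} {z} x≉0 xy≈xz with x⁻¹ , x⁻¹x≈1 ← left-inverse x x≉0 = begin
      y              ≈⟨ inverse-cancelˡ x⁻¹x≈1 y ⟨
      x⁻¹ * (x * y)  ≈⟨ *-congˡ xy≈xz ⟩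
      x⁻¹ * (x * z)  ≈⟨ inverse-cancelˡ x⁻¹x≈1 z ⟩
      z              ∎

    ∏-nonzero : ∀ {m} (f : Fin m → Carrier) → (∀ i → ¬ f i ≈ 0#) → ¬ ∏ f ≈ 0#
    ∏-nonzero {zero}  f f≉0 = 1≉0
    ∏-nonzero {suc m} f f≉0 = *-nonzero (f≉0 Fin.zero) (∏-nonzero (f ∘ Fin.suc) (f≉0 ∘ Fin.suc))

    zeroToOne : Carrier → Carrier
    zeroToOne x with x ≟ 0#
    ... | yes _ = 1#
    ... | no  _ = x

    zeroToOne-zero : ∀ {x} → x ≈ 0# → zeroToOne x ≈ 1#
    zeroToOne-zero {x} x≈0 with x ≟ 0#
    ... | yes _   = refl
    ... | no  x≉0 = contradiction x≈0 x≉0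

    zeroToOne-fixes-nonzero : ∀ {x} → ¬ x ≈ 0# → zeroToOne x ≈ x
    zeroToOne-fixes-nonzero {x} x≉0 with x ≟ 0#
    ... | yes x≈0 = contradiction x≈0 x≉0
    ... | no  _   = refl

    zeroToOne-cong : Congruent _≈_ _≈_ zeroToOne
    zeroToOne-cong {x} {y} x≈y with x ≟ 0#
    ... | yes x≈0 = sym (zeroToOne-zero (trans (sym x≈y) x≈0))
    ... | no  x≉0 = trans x≈y (sym (zeroToOne-fixes-nonzero (x≉0 ∘ trans x≈y)))

    zeroToOne≉0 : ∀ x → ¬ zeroToOne x ≈ 0#
    zeroToOne≉0 x with x ≟ 0#
    ... | yes _   = 1≉0
    ... | no  x≉0 = x≉0

    δ : Carrier → Fin N → Carrier
    δ a i with i Fin.≟ to 0#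
    ... | yes _ = a
    ... | no  _ = 1#

    ∏-δ : ∀ a → ∏ (δ a) ≈ a
    ∏-δ a = trans (sum-concentrated *-commutativeMonoid (δ a) (to 0#) δ-off) δ-at
      where
      δ-at : δ a (to 0#) ≈ a
      δ-at with to 0# Fin.≟ to 0#
      ... | yes _ = refl
      ... | no  ≢to0 = contradiction ≡.refl ≢to0

      δ-off : ∀ i → i ≢ to 0# → δ a i ≈ 1#
      δ-off i i≢ with i Fin.≟ to 0#
      ... | yes ≡to0 = contradiction ≡to0 i≢
      ... | no  _ = refl

    zeroToOne-scale : ∀ {a} → ¬ a ≈ 0# → ∀ i → zeroToOne (a * to⁻ i) * δ a i ≈ a * zeroToOne (to⁻ i)
    zeroToOne-scale {a} a≉0 i with i Fin.≟ to 0#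
    ... | yes ≡.refl = begin
      zeroToOne (a * to⁻ (to 0#)) * a  ≈⟨ *-congʳ (zeroToOne-zero (trans (*-congˡ (to⁻∘to 0#)) (zeroʳ a))) ⟩
      1# * a                          ≈⟨ *-comm 1# a ⟩
      a * 1#                          ≈⟨ *-congˡ (zeroToOne-zero (to⁻∘to 0#)) ⟨
      a * zeroToOne (to⁻ (to 0#))      ∎
    ... | no i≢ = begin
      zeroToOne (a * to⁻ i) * 1#  ≈⟨ *-identityʳ _ ⟩
      zeroToOne (a * to⁻ i)       ≈⟨ zeroToOne-fixes-nonzero (*-nonzero a≉0 to⁻i≉0) ⟩
      a * to⁻ i                   ≈⟨ *-congˡ (zeroToOne-fixes-nonzero to⁻i≉0) ⟨
      a * zeroToOne (to⁻ i)       ∎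
      where
      to⁻i≉0 : ¬ to⁻ i ≈ 0#
      to⁻i≉0 to⁻i≈0 = i≢ (to⁻-injective (trans to⁻i≈0 (sym (to⁻∘to 0#))))

    ∏-zeroToOne-invariant : ∀ {a} → ¬ a ≈ 0# → ∏ (λ i → zeroToOne (a * to⁻ i)) ≈ ∏ (zeroToOne ∘ to⁻)
    ∏-zeroToOne-invariant {a} a≉0 with a⁻¹ , a⁻¹a≈1 ← left-inverse a a≉0 = sym (begin
      ∏ (zeroToOne ∘ to⁻)                  ≈⟨ sum-permute (zeroToOne ∘ to⁻) π ⟩
      ∏ (λ i → zeroToOne (to⁻ (π ⟨$⟩ʳ i))) ≈⟨ sum-cong-≋ (λ i → zeroToOne-cong (to⁻∘to (a * to⁻ i))) ⟩
      ∏ (λ i → zeroToOne (a * to⁻ i))      ∎)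
      where
      π : Permutation N N
      π = toPermutation *-congˡ *-congˡ
        (inverse-cancelˡ (trans (*-comm a a⁻¹) a⁻¹a≈1)) (inverse-cancelˡ a⁻¹a≈1)

    -- Multiplication by x ≉ 0 permutes the field, so it fixes the product P of all elements
    -- with 0 replaced by 1; collecting the factors x gives x^N P = P x, the factor missing at 0
    -- being supplied by δ x.
    x^N≈x : ∀ x → x ^ᴿ N ≈ x
    x^N≈x x with x ≟ 0#
    ... | yes x≈0 = trans (^-congˡ N x≈0) (trans (0#^nonempty (to 0#)) (sym x≈0))
    ... | no  x≉0 = *-cancelˡ-nonzero P≉0 (begin
      P * x ^ᴿ N                               ≈⟨ *-comm P _ ⟩
      x ^ᴿ N * P                               ≈⟨ *-congʳ (sum-replicate N) ⟨
      ∏ (replicate N x) * P                    ≈⟨ ∑-distrib-+ (replicate N x) (zeroToOne ∘ to⁻) ⟨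
      ∏ (λ i → x * zeroToOne (to⁻ i))          ≈⟨ sum-cong-≋ (zeroToOne-scale x≉0) ⟨
      ∏ (λ i → zeroToOne (x * to⁻ i) * δ x i)  ≈⟨ ∑-distrib-+ (λ i → zeroToOne (x * to⁻ i)) (δ x) ⟩
      ∏ (λ i → zeroToOne (x * to⁻ i)) * ∏ (δ x) ≈⟨ *-cong (∏-zeroToOne-invariant x≉0) (∏-δ x) ⟩
      P * x                                    ∎)
      where
      P : Carrier
      P = ∏ (zeroToOne ∘ to⁻)

      P≉0 : ¬ P ≈ 0#
      P≉0 = ∏-nonzero (zeroToOne ∘ to⁻) (zeroToOne≉0 ∘ to⁻)

module Frobenius {c ℓ} (R : CommutativeRing c ℓ) where
  open CommutativeRing R
  open RawSemiring (Semiring.rawSemiring semiring) using () renaming (_^_ to _^ᴿ_)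
  open import Algebra.Properties.Semiring.Exp semiring using (^-congˡ; ^-congʳ; ^-homo-*; ^-assocʳ)
  open import Algebra.Solver.CommutativeMonoid +-commutativeMonoid using (solve; _⊕_; _⊜_)
  open import Relation.Binary.Reasoning.Setoid setoid

  frobenius : ℕ → Carrier → Carrier
  frobenius m x = x ^ᴿ (2 ℕ.^ m)

  frobenius-zero : ∀ x → frobenius 0 x ≈ x
  frobenius-zero = *-identityʳ

  frobenius-suc : ∀ m x → frobenius (suc m) x ≈ frobenius m x * frobenius m x
  frobenius-suc m x = trans (^-homo-* x (2 ℕ.^ m) (2 ℕ.^ m ℕ.+ 0))
                            (*-congˡ (^-congʳ x (+-identityʳ-ℕ (2 ℕ.^ m))))

  frobenius-1 : ∀ x → frobenius 1 x ≈ x * x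
  frobenius-1 x = trans (frobenius-suc 0 x) (*-cong (frobenius-zero x) (frobenius-zero x))

  frobenius-cong : ∀ m → Congruent _≈_ _≈_ (frobenius m)
  frobenius-cong m = ^-congˡ (2 ℕ.^ m)

  frobenius-idempotent : ∀ m {x} → x * x ≈ x → frobenius m x ≈ x
  frobenius-idempotent zero    {x} _     = frobenius-zero x
  frobenius-idempotent (suc m) {x} xx≈x = trans (frobenius-suc m x)
    (trans (*-cong (frobenius-idempotent m xx≈x) (frobenius-idempotent m xx≈x)) xx≈x)

  frobenius-0# : ∀ m → frobenius m 0# ≈ 0#
  frobenius-0# m = frobenius-idempotent m (zeroˡ 0#)

  frobenius-+-index : ∀ m p x → frobenius (m ℕ.+ p) x ≈ frobenius p (frobenius m x)
  frobenius-+-index m p x = begin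
    x ^ᴿ (2 ℕ.^ (m ℕ.+ p))          ≡⟨ ≡.cong (x ^ᴿ_) (^-distribˡ-+-* 2 m p) ⟩
    x ^ᴿ (2 ℕ.^ m ℕ.* 2 ℕ.^ p)      ≈⟨ ^-assocʳ x (2 ℕ.^ m) (2 ℕ.^ p) ⟨
    (x ^ᴿ (2 ℕ.^ m)) ^ᴿ (2 ℕ.^ p)   ∎

  frobenius-3* : ∀ k x → frobenius (3 ℕ.* k) x ≈ frobenius k (frobenius k (frobenius k x))
  frobenius-3* k x = begin
    frobenius (k ℕ.+ (k ℕ.+ (k ℕ.+ 0))) x  ≈⟨ frobenius-+-index k (k ℕ.+ (k ℕ.+ 0)) x ⟩
    frobenius (k ℕ.+ (k ℕ.+ 0)) σx        ≈⟨ frobenius-+-index k (k ℕ.+ 0) σx ⟩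
    frobenius (k ℕ.+ 0) σσx               ≈⟨ frobenius-+-index k 0 σσx ⟩
    frobenius 0 (frobenius k σσx)         ≈⟨ frobenius-zero _ ⟩
    frobenius k σσx                       ∎
    where
    σx = frobenius k x
    σσx = frobenius k σx

  fixed-multiple : ∀ q m {a} → frobenius m a ≈ a → frobenius (q ℕ.* m) a ≈ a
  fixed-multiple zero    m {a} _      = frobenius-zero a
  fixed-multiple (suc q) m {a} σᵐa≈a = begin
    frobenius (m ℕ.+ q ℕ.* m) a         ≈⟨ frobenius-+-index m (q ℕ.* m) a ⟩
    frobenius (q ℕ.* m) (frobenius m a) ≈⟨ frobenius-cong (q ℕ.* m) σᵐa≈a ⟩
    frobenius (q ℕ.* m) a               ≈⟨ fixed-multiple q m σᵐa≈a ⟩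
    a                                   ∎

  φ-cong : ∀ k → Congruent (_≈²_ R) (_≈²_ R) (φ R k)
  φ-cong k (x₁≈x₂ , y₁≈y₂) =
    +-cong (frobenius-cong k x₁≈x₂) y₁≈y₂ , +-cong (+-cong (frobenius-cong k y₁≈y₂) x₁≈x₂) y₁≈y₂

  module Characteristic2 (1+1≈0 : 1# + 1# ≈ 0#) where

    x+x≈0 : ∀ x → x + x ≈ 0#
    x+x≈0 x = begin
      x + x            ≈⟨ +-cong (*-identityˡ x) (*-identityˡ x) ⟨
      1# * x + 1# * x  ≈⟨ distribʳ x 1# 1# ⟨
      (1# + 1#) * x    ≈⟨ *-congʳ 1+1≈0 ⟩
      0# * x           ≈⟨ zeroˡ x ⟩
      0#               ∎

    x+y≈0⇒x≈y : ∀ {x y} → x + y ≈ 0# → x ≈ y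
    x+y≈0⇒x≈y {x} {y} x+y≈0 = begin
      x              ≈⟨ +-identityʳ x ⟨
      x + 0#         ≈⟨ +-congˡ (x+x≈0 y) ⟨
      x + (y + y)    ≈⟨ +-assoc x y y ⟨
      (x + y) + y    ≈⟨ +-congʳ x+y≈0 ⟩
      0# + y         ≈⟨ +-identityˡ y ⟩
      y              ∎

    x≈y⇒x+y≈0 : ∀ {x y} → x ≈ y → x + y ≈ 0#
    x≈y⇒x+y≈0 {x} {y} x≈y = trans (+-congʳ x≈y) (x+x≈0 y)

    square-homo-+ : ∀ x y → (x + y) * (x + y) ≈ x * x + y * y
    square-homo-+ x y = begin
      (x + y) * (x + y)                  ≈⟨ distribʳ (x + y) x y ⟩
      x * (x + y) + y * (x + y)          ≈⟨ +-cong (distribˡ x x y) (trans (*-comm y (x + y)) (distribʳ y x y)) ⟩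
      (x * x + x * y) + (x * y + y * y)  ≈⟨ solve 3 (λ a b c → (a ⊕ b) ⊕ (b ⊕ c) ⊜ (a ⊕ c) ⊕ (b ⊕ b))
                                                  refl (x * x) (x * y) (y * y) ⟩
      x * x + y * y + (x * y + x * y)    ≈⟨ +-congˡ (x+x≈0 (x * y)) ⟩
      x * x + y * y + 0#                 ≈⟨ +-identityʳ _ ⟩
      x * x + y * y                      ∎

    frobenius-homo-+ : ∀ m x y → frobenius m (x + y) ≈ frobenius m x + frobenius m y
    frobenius-homo-+ zero    x y = trans (frobenius-zero (x + y)) (sym (+-cong (frobenius-zero x) (frobenius-zero y)))
    frobenius-homo-+ (suc m) x y = begin
      frobenius (suc m) (x + y)                  ≈⟨ frobenius-suc m (x + y) ⟩
      frobenius m (x + y) * frobenius m (x + y)  ≈⟨ *-cong (frobenius-homo-+ m x y) (frobenius-homo-+ m x y) ⟩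
      (σx + σy) * (σx + σy)                      ≈⟨ square-homo-+ σx σy ⟩
      σx * σx + σy * σy                          ≈⟨ +-cong (frobenius-suc m x) (frobenius-suc m y) ⟨
      frobenius (suc m) x + frobenius (suc m) y  ∎
      where
      σx = frobenius m x
      σy = frobenius m y

    frobenius-cubic : ∀ k {a} → frobenius k (frobenius k a) + a + frobenius k a ≈ 0# → frobenius (3 ℕ.* k) a ≈ a
    frobenius-cubic k {a} σσa+a+σa≈0 = begin
      frobenius (3 ℕ.* k) a  ≈⟨ frobenius-3* k a ⟩
      σσσa                   ≈⟨ x+y≈0⇒x≈y (trans (sym (+-assoc σσσa σa σσa)) σ[σσa+a+σa]≈0) ⟩
      σa + σσa               ≈⟨ x+y≈0⇒x≈y (trans a+σa+σσa≈σσa+a+σa σσa+a+σa≈0) ⟨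
      a                      ∎
      where
      σa = frobenius k a
      σσa = frobenius k σa
      σσσa = frobenius k σσa

      a+σa+σσa≈σσa+a+σa : a + (σa + σσa) ≈ σσa + a + σa
      a+σa+σσa≈σσa+a+σa = solve 3 (λ x y z → x ⊕ (y ⊕ z) ⊜ (z ⊕ x) ⊕ y) refl a σa σσa

      σ[σσa+a+σa]≈0 : σσσa + σa + σσa ≈ 0#
      σ[σσa+a+σa]≈0 = begin
        σσσa + σa + σσa                  ≈⟨ +-congʳ (frobenius-homo-+ k σσa a) ⟨
        frobenius k (σσa + a) + σσa      ≈⟨ frobenius-homo-+ k (σσa + a) σa ⟨
        frobenius k (σσa + a + σa)       ≈⟨ frobenius-cong k σσa+a+σa≈0 ⟩
        frobenius k 0#                   ≈⟨ frobenius-0# k ⟩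
        0#                               ∎

    _+²_ : Carrier × Carrier → Carrier × Carrier → Carrier × Carrier
    (x₁ , y₁) +² (x₂ , y₂) = (x₁ + x₂ , y₁ + y₂)

    φ-homo-+ : ∀ k p q → _≈²_ R (φ R k (p +² q)) (φ R k p +² φ R k q)
    φ-homo-+ k (x₁ , y₁) (x₂ , y₂) =
      trans (+-congʳ (frobenius-homo-+ k x₁ x₂))
            (solve 4 (λ a b c d → (a ⊕ b) ⊕ (c ⊕ d) ⊜ (a ⊕ c) ⊕ (b ⊕ d))
                   refl (frobenius k x₁) (frobenius k x₂) y₁ y₂) ,
      trans (+-congʳ (+-congʳ (frobenius-homo-+ k y₁ y₂)))
            (solve 6 (λ a b c d e f → ((a ⊕ b) ⊕ (c ⊕ d)) ⊕ (e ⊕ f) ⊜ ((a ⊕ c) ⊕ e) ⊕ ((b ⊕ d) ⊕ f))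
                   refl (frobenius k y₁) (frobenius k y₂) x₁ x₂ y₁ y₂)

module GaloisField {c ℓ} (n : ℕ) (R : CommutativeRing c ℓ) (F : IsField𝔽2^ n R) where
  open CommutativeRing R
  open IsField𝔽2^ F
  open Frobenius R
  open Frobenius.Characteristic2 R char2
  open Field.Finite R nontrivial inverse card using (x^N≈x; x*x≈0⇒x≈0)
  open import Relation.Binary.Reasoning.Setoid setoid

  square-injective : ∀ {x y} → x * x ≈ y * y → x ≈ y
  square-injective {x} {y} xx≈yy = x+y≈0⇒x≈y (x*x≈0⇒x≈0 (trans (square-homo-+ x y) (x≈y⇒x+y≈0 xx≈yy)))

  frobenius-injective : ∀ m → Injective _≈_ _≈_ (frobenius m)
  frobenius-injective zero    {x} {y} σx≈σy = trans (sym (frobenius-zero x)) (trans σx≈σy (frobenius-zero y))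
  frobenius-injective (suc m) {x} {y} σx≈σy =
    frobenius-injective m (square-injective (trans (sym (frobenius-suc m x)) (trans σx≈σy (frobenius-suc m y))))

  fixed-difference : ∀ d q {r a} → d ℕ.+ q ≡ r → frobenius r a ≈ a → frobenius q a ≈ a → frobenius d a ≈ a
  fixed-difference d q {a = a} ≡.refl σʳa≈a σᑫa≈a = frobenius-injective q (begin
    frobenius q (frobenius d a) ≈⟨ frobenius-+-index d q a ⟨
    frobenius (d ℕ.+ q) a       ≈⟨ σʳa≈a ⟩
    a                           ≈⟨ σᑫa≈a ⟨
    frobenius q a               ∎)

  fixed-gcd : ∀ {m p d a} → GCD m p d → frobenius m a ≈ a → frobenius p a ≈ a → frobenius d a ≈ a
  fixed-gcd {m} {p} {d} gcd σᵐa≈a σᵖa≈a with Bézout.identity gcd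
  ... | Bézout.+- x y d+yp≡xm =
    fixed-difference d (y ℕ.* p) d+yp≡xm (fixed-multiple x m σᵐa≈a) (fixed-multiple y p σᵖa≈a)
  ... | Bézout.-+ x y d+xm≡yp =
    fixed-difference d (x ℕ.* m) d+xm≡yp (fixed-multiple y p σᵖa≈a) (fixed-multiple x m σᵐa≈a)

  module _ (k : ℕ) (coprime : gcd (3 ℕ.* k) n ≡ 1) where

    φ-kernel : ∀ {a b} → _≈²_ R (φ R k (a , b)) (0# , 0#) → _≈²_ R (a , b) (0# , 0#)
    φ-kernel {a} {b} (σa+b≈0 , σb+a+b≈0) = a≈0 , trans b≈σa (trans σa≈a a≈0)
      where
      b≈σa : b ≈ frobenius k a
      b≈σa = sym (x+y≈0⇒x≈y σa+b≈0)

      σσa+a+σa≈0 : frobenius k (frobenius k a) + a + frobenius k a ≈ 0#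
      σσa+a+σa≈0 = trans (+-cong (+-congʳ (frobenius-cong k (sym b≈σa))) (sym b≈σa)) σb+a+b≈0

      GCD[3k,n]≡1 : GCD (3 ℕ.* k) n 1
      GCD[3k,n]≡1 = ≡.subst (GCD (3 ℕ.* k) n) coprime (gcd-GCD (3 ℕ.* k) n)

      σa≈a : frobenius k a ≈ a
      σa≈a = frobenius-idempotent k (begin
        a * a          ≈⟨ frobenius-1 a ⟨
        frobenius 1 a  ≈⟨ fixed-gcd GCD[3k,n]≡1 (frobenius-cubic k σσa+a+σa≈0) (x^N≈x a) ⟩
        a              ∎)

      a≈0 : a ≈ 0#
      a≈0 = begin
        a                                                ≈⟨ +-identityˡ a ⟨
        0# + a                                           ≈⟨ +-congʳ (x+x≈0 a) ⟨
        a + a + a                                        ≈⟨ +-cong (+-congʳ (trans (frobenius-cong k σa≈a) σa≈a)) σa≈a ⟨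
        frobenius k (frobenius k a) + a + frobenius k a  ≈⟨ σσa+a+σa≈0 ⟩
        0#                                               ∎

    φ-injective : Injective (_≈²_ R) (_≈²_ R) (φ R k)
    φ-injective {x₁ , y₁} {x₂ , y₂} (φ₁≈φ₂ , φ₁′≈φ₂′) =
      x+y≈0⇒x≈y (proj₁ p+q≈0) , x+y≈0⇒x≈y (proj₂ p+q≈0)
      where
      homo : _≈²_ R (φ R k (x₁ + x₂ , y₁ + y₂)) (φ R k (x₁ , y₁) +² φ R k (x₂ , y₂))
      homo = φ-homo-+ k (x₁ , y₁) (x₂ , y₂)

      p+q≈0 : _≈²_ R (x₁ + x₂ , y₁ + y₂) (0# , 0#)
      p+q≈0 = φ-kernel ( trans (proj₁ homo) (x≈y⇒x+y≈0 φ₁≈φ₂)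
                       , trans (proj₂ homo) (x≈y⇒x+y≈0 φ₁′≈φ₂′))

    φ-surjective : Surjective (_≈²_ R) (_≈²_ R) (φ R k)
    φ-surjective = FiniteSetoid.injective⇒surjective (setoid ×ₛ setoid) (×-finite card card) (φ-cong k) φ-injective

lemma3p13 : {c ℓ : Level} (n k : ℕ) → 1 ≤ n → 1 ≤ k → gcd (3 ℕ.* k) n ≡ 1 →
    (R : CommutativeRing c ℓ) → IsField𝔽2^ n R → φ-Bijective R k
lemma3p13 n k _ _ coprime R F = φ-injective k coprime , φ-surjective k coprime
  where open GaloisField n R F
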